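{- Let $G$ be an OTG with $n$ vertices and let $X\subseteq V(G)$. Suppose $u,v$ are two nonadjacent vertices of $G$ with $d(u)+d(v)\geq n+1$. Then (1) $X$ is an $H$-force set of $G$ if and only if $X$ is an $H$-force set of $G+uv$; and (2) $X$ is a minimum $H$-force set of $G$ if and only if $X$ is a minimum $H$-force set of $G+uv$; in particular $h(G)=h(G+uv)$.
   Context: All graphs are finite and simple. A graph $G$ with $n$ vertices is called an OTG if $d(u)+d(v)\geq n$ for every pair of distinct nonadjacent vertices $u,v$ of $G$ (by Ore's theorem such a graph with $n\ge 3$ is Hamiltonian). For $X\subseteq V(G)$, an $X$-cycle of $G$ is a cycle of $G$ containing all vertices of $X$. For a Hamiltonian graph $G$, a nonempty set $X\subseteq V(G)$ is an $H$-force set of $G$ if every $X$-cycle of $G$ is a Hamiltonian cycle; $h(G)$, the $H$-force number, is the smallest cardinality of an $H$-force set of $G$; a minimum $H$-force set is an $H$-force set $X$ such that no $H$-force set $X'$ has $|X'|<|X|$. $G+uv$ denotes the graph obtained from $G$ by adding the edge $uv$. -}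

module Defs where

open import Data.Nat using (ℕ; zero; suc; _+_; _≤_)
open import Data.Bool using (Bool; true; false; _∨_; _∧_; if_then_else_)
open import Data.Fin using (Fin)
open import Data.Fin.Properties using (_≟_)
open import Data.List using (List; []; _∷_; _++_; take; length; map; allFin)
open import Data.Nat.ListAction using (sum)
open import Data.List.Membership.Propositional using () renaming (_∈_ to _∈ˡ_)
open import Data.List.Relation.Unary.Unique.Propositional using (Unique)
open import Data.List.Relation.Unary.Linked using (Linked)
open import Data.Fin.Subset using (Subset; Nonempty; ∣_∣) renaming (_∈_ to _∈ˢ_)
open import Data.Product using (_×_; Σ; ∃)
open import Relation.Nullary using (¬_)
open import Relation.Nullary.Decidable using (⌊_⌋)
open import Relation.Binary.PropositionalEquality using (_≡_; _≢_)

Graph : ℕ → Set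
Graph n = Fin n → Fin n → Bool

Adj : ∀ {n} → Graph n → Fin n → Fin n → Set
Adj G x y = G x y ≡ true

IsSimple : ∀ {n} → Graph n → Set
IsSimple G = (∀ x y → G x y ≡ G y x) × (∀ x → G x x ≡ false)

b2n : Bool → ℕ
b2n true  = 1
b2n false = 0

deg : ∀ {n} → Graph n → Fin n → ℕ
deg {n} G u = sum (map (λ w → b2n (G u w)) (allFin n))

IsOTG : ∀ {n} → Graph n → Set
IsOTG {n} G = ∀ x y → x ≢ y → ¬ Adj G x y → n ≤ deg G x + deg G y

addEdge : ∀ {n} → Graph n → Fin n → Fin n → Graph n
addEdge G u v x y =
  G x y ∨ ((⌊ x ≟ u ⌋ ∧ ⌊ y ≟ v ⌋) ∨ (⌊ x ≟ v ⌋ ∧ ⌊ y ≟ u ⌋))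

-- A cycle, given by its list of distinct vertices in cyclic order
-- (at least 3 of them, consecutive ones adjacent, last adjacent to first).
IsCycle : ∀ {n} → Graph n → List (Fin n) → Set
IsCycle G xs = (3 ≤ length xs) × Unique xs × Linked (Adj G) (xs ++ take 1 xs)

IsHamCycle : ∀ {n} → Graph n → List (Fin n) → Set
IsHamCycle G xs = IsCycle G xs × (∀ v → v ∈ˡ xs)

Hamiltonian : ∀ {n} → Graph n → Set
Hamiltonian G = ∃ λ xs → IsHamCycle G xs

IsXCycle : ∀ {n} → Graph n → Subset n → List (Fin n) → Set
IsXCycle G X xs = IsCycle G xs × (∀ v → v ∈ˢ X → v ∈ˡ xs)

IsHForceSet : ∀ {n} → Graph n → Subset n → Set
IsHForceSet G X =
  Hamiltonian G × Nonempty X × (∀ xs → IsXCycle G X xs → IsHamCycle G xs)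

IsMinHForceSet : ∀ {n} → Graph n → Subset n → Set
IsMinHForceSet G X = IsHForceSet G X × (∀ Y → IsHForceSet G Y → ∣ X ∣ ≤ ∣ Y ∣)

HForceNumber : ∀ {n} → Graph n → ℕ → Set
HForceNumber G k = Σ _ λ X → IsMinHForceSet G X × ∣ X ∣ ≡ k

-- Take a cycle C of G + uv that uses the new edge; it is a u…v path π of G.  Since
-- d(u) + d(v) ≥ n + 1, π closes up inside G (the Ore rotation).  If some consecutive
-- p, q on π have v ~ p and u ~ q, then u…p v…q u is a cycle of G on exactly the
-- vertices of π.  Otherwise every consecutive pair of π carries at most one of these
-- adjacencies, so u and v have fewer than |π| neighbours on π, and more than n − |π| + 1
-- off π: they have a common neighbour w off π, and π + w is a cycle of G, which by the
-- same count cannot be Hamiltonian.  So every cycle of G + uv lies in a cycle of G that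
-- is Hamiltonian only if the former is, while every cycle of G is one of G + uv; hence G
-- and G + uv have the same H-force sets.

module Submission where

open import Defs
open import Data.Nat using (ℕ; suc; _+_; _≤_; _<_; _≤?_; z≤n; s≤s)
open import Data.Nat.Properties
  using ( ≰⇒>; +-mono-≤; +-monoˡ-≤; +-monoʳ-≤; +-comm; +-identityʳ; ≤-trans; n≤1+n; <⇒≤; <⇒≱; 1+n≰n
        ; +-commutativeSemigroup; module ≤-Reasoning)
open import Algebra.Properties.CommutativeSemigroup +-commutativeSemigroup using (interchange)
open import Data.Nat.Tactic.RingSolver using (solve-∀)
open import Data.Nat.ListAction using (sum)
open import Data.Nat.ListAction.Properties using (sum-++; sum-↭)
open import Data.Fin using (Fin)
open import Data.Fin.Properties using (_≟_; any?)
open import Data.Bool using (true; false; T; _∧_)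
import Data.Bool as Bool
open import Data.Bool.Properties using (¬-not; T-≡; T-∨)
open import Data.Fin.Subset using (Subset)
open import Data.Product using (_×_; ∃; ∃₂; _,_; proj₁; proj₂)
import Data.Product as Prod
open import Data.Sum using (_⊎_; inj₁; inj₂)
import Data.Sum
open import Data.Empty using (⊥-elim)
open import Function using (_∘_)
open import Data.List using (List; []; _∷_; _++_; _∷ʳ_; [_]; take; length; reverse; map; initLast; _∷ʳ′_; allFin)
open import Data.List.Properties using (++-assoc; ++-identityʳ; unfold-reverse; reverse-++; map-++; length-++; length-tabulate)
open import Data.List.Relation.Unary.All.Properties using (¬Any⇒All¬)
open import Data.List.Relation.Unary.Linked as Linked using (Linked; []; [-]; _∷_)
open import Data.List.Relation.Unary.Any using (here; there)
open import Data.List.Membership.Propositional using (_∈_; _∉_)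
open import Data.List.Membership.Propositional.Properties using (∈-∃++; ∈-++⁺ˡ; ∈-++⁺ʳ; ∈-allFin)
import Data.List.Membership.DecPropositional as DecMembership
open import Data.List.Relation.Unary.Unique.Propositional using (Unique)
open import Data.List.Relation.Unary.Unique.Propositional.Properties using (Unique[x∷xs]⇒x∉xs; allFin⁺)
import Data.List.Relation.Unary.AllPairs as AllPairs
open import Data.List.Relation.Binary.Permutation.Propositional
  using (_↭_; ↭-refl; ↭-sym; ↭-trans; ↭-prep; ↭⇒↭ₛ; module PermutationReasoning)
import Data.List.Relation.Binary.Permutation.Setoid.Properties as Permutationₛ
open import Data.List.Relation.Binary.Permutation.Propositional.Properties
  using (++-comm; ++⁺ˡ; ++⁺ʳ; ↭-reverse; shift; ∈-resp-↭; ↭-length; map⁺; ∷↭∷ʳ)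
open import Relation.Nullary using (¬_; yes; no; ¬?; _×-dec_)
open import Relation.Nullary.Decidable using (Dec; ⌊_⌋)
open import Function.Bundles using (Equivalence; _⇔_; mk⇔)
import Relation.Binary as B
open import Relation.Binary.PropositionalEquality
  using (_≡_; _≢_; refl; sym; trans; cong; cong₂; subst; setoid; module ≡-Reasoning)

Cyclic : {A : Set} → (A → A → Set) → List A → Set
Cyclic R xs = Linked R (xs ++ take 1 xs)

module _ {A : Set} {R : A → A → Set} where

  Linked-split : ∀ xs {y ys} → Linked R (xs ++ y ∷ ys) → Linked R (xs ∷ʳ y) × Linked R (y ∷ ys)
  Linked-split []            l       = [-] , l
  Linked-split (x ∷ [])      (r ∷ l) = r ∷ [-] , l
  Linked-split (x ∷ x′ ∷ xs) (r ∷ l) = Prod.map₁ (r ∷_) (Linked-split (x′ ∷ xs) l)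

  Linked-join : ∀ xs {y ys} → Linked R (xs ∷ʳ y) → Linked R (y ∷ ys) → Linked R (xs ++ y ∷ ys)
  Linked-join []            _       l = l
  Linked-join (x ∷ [])      (r ∷ _) l = r ∷ l
  Linked-join (x ∷ x′ ∷ xs) (r ∷ k) l = r ∷ Linked-join (x′ ∷ xs) k l

  Linked-middle : ∀ xs {p q ys} → Linked R (xs ++ p ∷ q ∷ ys) → R p q
  Linked-middle xs l = Linked.head (proj₂ (Linked-split xs l))

  Linked-∷ʳ : ∀ {xs z} → (∀ y → R y z) → Linked R xs → Linked R (xs ∷ʳ z)
  Linked-∷ʳ R·z []      = [-]
  Linked-∷ʳ R·z [-]     = R·z _ ∷ [-]
  Linked-∷ʳ R·z (r ∷ l) = r ∷ Linked-∷ʳ R·z l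

  Linked-∷ : ∀ {x xs} → (∀ y → R x y) → Linked R xs → Linked R (x ∷ xs)
  Linked-∷ Rx· []      = [-]
  Linked-∷ Rx· [-]     = Rx· _ ∷ [-]
  Linked-∷ Rx· (r ∷ l) = Rx· _ ∷ r ∷ l

  Linked-reverse : B.Symmetric R → ∀ {xs} → Linked R xs → Linked R (reverse xs)
  Linked-reverse R-sym []      = []
  Linked-reverse R-sym [-]     = [-]
  Linked-reverse R-sym {x ∷ y ∷ xs} (r ∷ l) = subst (Linked R) (sym eq)
    (Linked-join (reverse xs) (subst (Linked R) (unfold-reverse y xs) (Linked-reverse R-sym l)) (R-sym r ∷ [-]))
    where
    eq : reverse (x ∷ y ∷ xs) ≡ reverse xs ++ y ∷ [ x ]
    eq = trans (unfold-reverse x (y ∷ xs))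
           (trans (cong (_∷ʳ x) (unfold-reverse y xs)) (++-assoc (reverse xs) [ y ] [ x ]))

  Linked-break : B.Decidable R → ∀ xs →
    Linked R xs ⊎ ∃₂ λ as bs → ∃₂ λ p q → xs ≡ as ++ p ∷ q ∷ bs × ¬ R p q
  Linked-break R? []           = inj₁ []
  Linked-break R? (x ∷ [])     = inj₁ [-]
  Linked-break R? (x ∷ y ∷ xs) with R? x y | Linked-break R? (y ∷ xs)
  ... | no ¬r | _                              = inj₂ ([] , xs , x , y , refl , ¬r)
  ... | yes r | inj₁ l                         = inj₁ (r ∷ l)
  ... | yes r | inj₂ (as , bs , p , q , eq , ¬r) = inj₂ (x ∷ as , bs , p , q , cong (x ∷_) eq , ¬r)

  Cyclic-∷ʳ⁻ : ∀ {x xs y} → Cyclic R (x ∷ xs ∷ʳ y) → Linked R (x ∷ xs ∷ʳ y) × R y x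
  Cyclic-∷ʳ⁻ {x} {xs} {y} c =
    Prod.map₂ Linked.head (Linked-split (x ∷ xs) (subst (Linked R) (cong (x ∷_) (++-assoc xs [ y ] [ x ])) c))

  Cyclic-∷ʳ⁺ : ∀ {x xs y} → Linked R (x ∷ xs ∷ʳ y) → R y x → Cyclic R (x ∷ xs ∷ʳ y)
  Cyclic-∷ʳ⁺ {x} {xs} {y} l r =
    subst (Linked R) (cong (x ∷_) (sym (++-assoc xs [ y ] [ x ]))) (Linked-join (x ∷ xs) l (r ∷ [-]))

  Cyclic-rotate : ∀ xs ys → Cyclic R (xs ++ ys) → Cyclic R (ys ++ xs)
  Cyclic-rotate [] ys c = subst (Cyclic R) (sym (++-identityʳ ys)) c
  Cyclic-rotate (x ∷ xs) [] c = subst (Cyclic R) (++-identityʳ (x ∷ xs)) c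
  Cyclic-rotate (x ∷ xs) (y ∷ ys) c =
    let x…y , y…x = Linked-split (x ∷ xs) (subst (Linked R) (cong (x ∷_) (++-assoc xs (y ∷ ys) [ x ])) c)
    in subst (Linked R) (cong (y ∷_) (sym (++-assoc ys (x ∷ xs) [ y ]))) (Linked-join (y ∷ ys) y…x x…y)

∷-∷ʳ-view : ∀ {A : Set} (xs : List A) → 2 ≤ length xs → ∃₂ λ x ys → ∃ λ y → xs ≡ x ∷ ys ∷ʳ y
∷-∷ʳ-view (x ∷ xs) 2≤ with initLast xs
∷-∷ʳ-view (x ∷ .[]) (s≤s ()) | []
∷-∷ʳ-view (x ∷ ._)  _        | ys ∷ʳ′ y = x , ys , y , refl

module _ {A : Set} {R S : A → A → Set} where

  Cyclic-open : B.Decidable R → ∀ {xs} → 2 ≤ length xs → Cyclic S xs →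
    Cyclic R xs ⊎ ∃₂ λ p q → ∃ λ ms → S p q × ¬ R p q × Linked S (q ∷ ms ∷ʳ p) × (q ∷ ms ∷ʳ p) ↭ xs
  Cyclic-open R? {xs} 2≤ c with ∷-∷ʳ-view xs 2≤
  ... | x , ys , y , refl with Cyclic-∷ʳ⁻ {R = S} c | R? y x | Linked-break R? (x ∷ ys ∷ʳ y)
  ...   | path , Syx | no ¬Ryx | _      = inj₂ (y , x , ys , Syx , ¬Ryx , path , ↭-refl)
  ...   | _          | yes Ryx | inj₁ l = inj₁ (Cyclic-∷ʳ⁺ l Ryx)
  ...   | path , _   | yes _   | inj₂ (as , bs , p , q , eq , ¬Rpq) =
    inj₂ (p , q , bs ++ as , Linked-middle as (subst (Linked S) eq path) , ¬Rpq , rotated , perm)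
    where
    split : x ∷ ys ∷ʳ y ≡ (as ∷ʳ p) ++ q ∷ bs
    split = trans eq (sym (++-assoc as [ p ] (q ∷ bs)))
    reassoc : (q ∷ bs) ++ (as ∷ʳ p) ≡ q ∷ (bs ++ as) ∷ʳ p
    reassoc = cong (q ∷_) (sym (++-assoc bs as [ p ]))
    rotated : Linked S (q ∷ (bs ++ as) ∷ʳ p)
    rotated = proj₁ (Cyclic-∷ʳ⁻ (subst (Cyclic S) reassoc
                (Cyclic-rotate (as ∷ʳ p) (q ∷ bs) (subst (Cyclic S) split c))))
    perm : q ∷ (bs ++ as) ∷ʳ p ↭ x ∷ ys ∷ʳ y
    perm = begin
      q ∷ (bs ++ as) ∷ʳ p   ≡⟨ reassoc ⟨
      (q ∷ bs) ++ as ∷ʳ p   ↭⟨ ++-comm (q ∷ bs) (as ∷ʳ p) ⟩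
      (as ∷ʳ p) ++ q ∷ bs   ≡⟨ split ⟨
      x ∷ ys ∷ʳ y           ∎
      where open PermutationReasoning

  Linked-avoiding : ∀ {z xs} → (∀ {x y} → S x y → R x y ⊎ (x ≡ z ⊎ y ≡ z)) → z ∉ xs → Linked S xs → Linked R xs
  Linked-avoiding new⇒z z∉ []      = []
  Linked-avoiding new⇒z z∉ [-]     = [-]
  Linked-avoiding new⇒z z∉ (s ∷ l) with new⇒z s
  ... | inj₁ r           = r ∷ Linked-avoiding new⇒z (z∉ ∘ there) l
  ... | inj₂ (inj₁ refl) = ⊥-elim (z∉ (here refl))
  ... | inj₂ (inj₂ refl) = ⊥-elim (z∉ (there (here refl)))

module _ {A : Set} {R : A → A → Set} (R-sym : B.Symmetric R) where

  Cyclic-crossing : ∀ {x y p q} as bs → Linked R (x ∷ (as ++ p ∷ q ∷ bs) ∷ʳ y) → R p y → R q x →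
    ∃ λ Γ → Cyclic R Γ × Γ ↭ x ∷ (as ++ p ∷ q ∷ bs) ∷ʳ y
  Cyclic-crossing {x} {y} {p} {q} as bs l Rpy Rqx =
    x ∷ (as ++ p ∷ y ∷ reverse bs) ∷ʳ q , Cyclic-∷ʳ⁺ (subst (Linked R) (sym reassoc) joined) Rqx , perm
    where
    reassoc : x ∷ (as ++ p ∷ y ∷ reverse bs) ∷ʳ q ≡ (x ∷ as) ++ p ∷ y ∷ reverse bs ∷ʳ q
    reassoc = cong (x ∷_) (++-assoc as (p ∷ y ∷ reverse bs) [ q ])
    reverse-tail : reverse (q ∷ bs ∷ʳ y) ≡ y ∷ reverse bs ∷ʳ q
    reverse-tail = trans (unfold-reverse q (bs ∷ʳ y)) (cong (_∷ʳ q) (reverse-++ bs [ y ]))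
    halves : Linked R (x ∷ as ∷ʳ p) × Linked R (p ∷ q ∷ bs ∷ʳ y)
    halves = Linked-split (x ∷ as) (subst (Linked R) (cong (x ∷_) (++-assoc as (p ∷ q ∷ bs) [ y ])) l)
    joined : Linked R ((x ∷ as) ++ p ∷ y ∷ reverse bs ∷ʳ q)
    joined = Linked-join (x ∷ as) (proj₁ halves)
               (Rpy ∷ subst (Linked R) reverse-tail (Linked-reverse R-sym (Linked.tail (proj₂ halves))))
    perm : x ∷ (as ++ p ∷ y ∷ reverse bs) ∷ʳ q ↭ x ∷ (as ++ p ∷ q ∷ bs) ∷ʳ y
    perm = begin
      x ∷ (as ++ p ∷ y ∷ reverse bs) ∷ʳ q  ≡⟨ reassoc ⟩
      x ∷ as ++ p ∷ y ∷ reverse bs ∷ʳ q    ≡⟨ cong (λ zs → x ∷ as ++ p ∷ zs) (sym reverse-tail) ⟩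
      x ∷ as ++ p ∷ reverse (q ∷ bs ∷ʳ y)  ↭⟨ ↭-prep x (++⁺ˡ as (↭-prep p (↭-reverse (q ∷ bs ∷ʳ y)))) ⟩
      x ∷ as ++ p ∷ q ∷ bs ∷ʳ y            ≡⟨ cong (x ∷_) (sym (++-assoc as (p ∷ q ∷ bs) [ y ])) ⟩
      x ∷ (as ++ p ∷ q ∷ bs) ∷ʳ y          ∎
      where open PermutationReasoning

module _ {A : Set} where

  Unique-resp-↭ : ∀ {xs ys : List A} → xs ↭ ys → Unique xs → Unique ys
  Unique-resp-↭ p = Permutationₛ.Unique-resp-↭ (setoid A) (↭⇒↭ₛ p)

  Unique-++-disjoint : ∀ (ys : List A) {zs w} → Unique (ys ++ zs) → w ∈ zs → w ∉ ys
  Unique-++-disjoint (y ∷ ys) u w∈zs (here refl)  = Unique[x∷xs]⇒x∉xs u (∈-++⁺ʳ ys w∈zs)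
  Unique-++-disjoint (y ∷ ys) u w∈zs (there w∈ys) = Unique-++-disjoint ys (AllPairs.tail u) w∈zs w∈ys

  sum-map-+ : ∀ (f g : A → ℕ) xs → sum (map (λ w → f w + g w) xs) ≡ sum (map f xs) + sum (map g xs)
  sum-map-+ f g []       = refl
  sum-map-+ f g (x ∷ xs) = trans (cong (f x + g x +_) (sum-map-+ f g xs)) (interchange (f x) (g x) _ _)

  sum-map-≤-length : ∀ (f : A → ℕ) xs → (∀ {w} → w ∈ xs → f w ≤ 1) → sum (map f xs) ≤ length xs
  sum-map-≤-length f []       _   = z≤n
  sum-map-≤-length f (x ∷ xs) f≤1 = +-mono-≤ (f≤1 (here refl)) (sum-map-≤-length f xs (f≤1 ∘ there))

module _ {A : Set} (_≟_ : B.DecidableEquality A) where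

  open DecMembership _≟_ using (_∈?_)

  ↭-complete : ∀ xs {ys : List A} → Unique ys → (∀ {w} → w ∈ ys → w ∈ xs) → ∃ λ zs → xs ↭ ys ++ zs
  ↭-complete []       {[]}    _   _     = [] , ↭-refl
  ↭-complete []       {_ ∷ _} _   ys⊆[] with ys⊆[] (here refl)
  ... | ()
  ↭-complete (x ∷ xs) {ys}    ys! ys⊆ with x ∈? ys
  ... | no x∉ys =
    let zs , xs↭ = ↭-complete xs ys! ys⊆xs in x ∷ zs , ↭-trans (↭-prep x xs↭) (↭-sym (shift x ys zs))
    where
    ys⊆xs : ∀ {w} → w ∈ ys → w ∈ xs
    ys⊆xs w∈ys with ys⊆ w∈ys
    ... | here refl  = ⊥-elim (x∉ys w∈ys)
    ... | there w∈xs = w∈xs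
  ... | yes x∈ys with ∈-∃++ x∈ys
  ...   | as , bs , refl =
    let zs , xs↭ = ↭-complete xs (AllPairs.tail x∷as++bs!) as++bs⊆xs
    in zs , ↭-trans (↭-prep x xs↭) (++⁺ʳ zs (↭-sym (shift x as bs)))
    where
    x∷as++bs! : Unique (x ∷ as ++ bs)
    x∷as++bs! = Unique-resp-↭ (shift x as bs) ys!
    as++bs⊆xs : ∀ {w} → w ∈ as ++ bs → w ∈ xs
    as++bs⊆xs w∈ with ys⊆ (∈-resp-↭ (↭-sym (shift x as bs)) (there w∈))
    ... | here refl  = ⊥-elim (Unique[x∷xs]⇒x∉xs x∷as++bs! w∈)
    ... | there w∈xs = w∈xs

  sum-≤-length : ∀ (f : A → ℕ) {xs ys} → Unique xs → Unique ys → (∀ {w} → w ∈ ys → w ∈ xs) →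
    (∀ w → w ∉ ys → f w ≤ 1) → sum (map f ys) ≤ length ys → sum (map f xs) ≤ length xs
  sum-≤-length f {xs} {ys} xs! ys! ys⊆xs f≤1 bound = begin
    sum (map f xs)                  ≡⟨ sum-↭ (map⁺ f xs↭) ⟩
    sum (map f (ys ++ zs))          ≡⟨ cong sum (map-++ f ys zs) ⟩
    sum (map f ys ++ map f zs)      ≡⟨ sum-++ (map f ys) (map f zs) ⟩
    sum (map f ys) + sum (map f zs) ≤⟨ +-mono-≤ bound (sum-map-≤-length f zs outside) ⟩
    length ys + length zs           ≡⟨ sym (length-++ ys) ⟩
    length (ys ++ zs)               ≡⟨ sym (↭-length xs↭) ⟩
    length xs                       ∎
    where
    open ≤-Reasoning
    completion : ∃ λ zs → xs ↭ ys ++ zs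
    completion = ↭-complete xs ys! ys⊆xs
    zs = proj₁ completion
    xs↭ = proj₂ completion
    outside : ∀ {w} → w ∈ zs → f w ≤ 1
    outside w∈zs = f≤1 _ (Unique-++-disjoint ys (Unique-resp-↭ xs↭ xs!) w∈zs)

module _ {A : Set} (a b : A → ℕ) where

  -- The sum telescopes into a x + Σ (b p + a q) over consecutive pairs p q + b z.
  sum-Linked-≤ : ∀ {x z} ys → Linked (λ p q → b p + a q ≤ 1) (x ∷ ys ∷ʳ z) →
    sum (map (λ w → a w + b w) (x ∷ ys ∷ʳ z)) ≤ a x + suc (length ys) + b z
  sum-Linked-≤ {x} {z} [] (bx+az≤1 ∷ [-]) = begin
    a x + b x + (a z + b z + 0) ≡⟨ regroup (a x) (b x) (a z) (b z) ⟩
    a x + (b x + a z) + b z     ≤⟨ +-monoˡ-≤ (b z) (+-monoʳ-≤ (a x) bx+az≤1) ⟩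
    a x + 1 + b z               ∎
    where
    open ≤-Reasoning
    regroup : ∀ ax bx az bz → ax + bx + (az + bz + 0) ≡ ax + (bx + az) + bz
    regroup = solve-∀
  sum-Linked-≤ {x} {z} (y ∷ ys) (bx+ay≤1 ∷ l) = begin
    a x + b x + sum (map (λ w → a w + b w) (y ∷ ys ∷ʳ z)) ≤⟨ +-monoʳ-≤ (a x + b x) (sum-Linked-≤ ys l) ⟩
    a x + b x + (a y + suc (length ys) + b z)            ≡⟨ regroup (a x) (b x) (a y) (length ys) (b z) ⟩
    a x + (b x + a y) + suc (length ys) + b z            ≤⟨ +-monoˡ-≤ (b z) (+-monoˡ-≤ (suc (length ys))
                                                                   (+-monoʳ-≤ (a x) bx+ay≤1)) ⟩
    a x + 1 + suc (length ys) + b z                      ≡⟨ cong (_+ b z) (regroup′ (a x) (length ys)) ⟩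
    a x + suc (suc (length ys)) + b z                    ∎
    where
    open ≤-Reasoning
    regroup : ∀ ax bx ay l bz → ax + bx + (ay + suc l + bz) ≡ ax + (bx + ay) + suc l + bz
    regroup = solve-∀
    regroup′ : ∀ ax l → ax + 1 + suc l ≡ ax + suc (suc l)
    regroup′ = solve-∀

Joins : {A : Set} → A → A → A → A → Set
Joins u v x y = (x ≡ u × y ≡ v) ⊎ (x ≡ v × y ≡ u)

module _ {A : Set} {u v : A} where

  Joins-sym : ∀ {x y} → Joins u v x y → Joins u v y x
  Joins-sym (inj₁ (x≡u , y≡v)) = inj₂ (y≡v , x≡u)
  Joins-sym (inj₂ (x≡v , y≡u)) = inj₁ (y≡u , x≡v)

  Joins-touches : ∀ {p q x y} → Joins u v p q → Joins u v x y → x ≡ p ⊎ y ≡ p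
  Joins-touches (inj₁ (refl , _)) (inj₁ (refl , _)) = inj₁ refl
  Joins-touches (inj₁ (refl , _)) (inj₂ (_ , refl)) = inj₂ refl
  Joins-touches (inj₂ (refl , _)) (inj₁ (_ , refl)) = inj₂ refl
  Joins-touches (inj₂ (refl , _)) (inj₂ (refl , _)) = inj₁ refl

T-⌊⌋∧⌊⌋ : ∀ {P Q : Set} (p? : Dec P) (q? : Dec Q) → T (⌊ p? ⌋ ∧ ⌊ q? ⌋) → P × Q
T-⌊⌋∧⌊⌋ (yes p) (yes q) _ = p , q
T-⌊⌋∧⌊⌋ (yes _) (no _)  ()
T-⌊⌋∧⌊⌋ (no _)  _       ()

b2n≤1 : ∀ β → b2n β ≤ 1
b2n≤1 true  = s≤s z≤n
b2n≤1 false = z≤n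

b2n+b2n≰1⇒both : ∀ β γ → ¬ b2n β + b2n γ ≤ 1 → β ≡ true × γ ≡ true
b2n+b2n≰1⇒both true  true  _  = refl , refl
b2n+b2n≰1⇒both true  false ≰1 = ⊥-elim (≰1 (s≤s z≤n))
b2n+b2n≰1⇒both false γ     ≰1 = ⊥-elim (≰1 (b2n≤1 γ))

¬both⇒b2n+b2n≤1 : ∀ β γ → ¬ (β ≡ true × γ ≡ true) → b2n β + b2n γ ≤ 1
¬both⇒b2n+b2n≤1 true  true  ¬both = ⊥-elim (¬both (refl , refl))
¬both⇒b2n+b2n≤1 true  false _     = s≤s z≤n
¬both⇒b2n+b2n≤1 false γ     _     = b2n≤1 γ

Spanning : ∀ {n} → List (Fin n) → Set
Spanning xs = ∀ w → w ∈ xs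

module _ {n} {G : Graph n} (simple : IsSimple G) where

  Adj-sym : ∀ {x y} → Adj G x y → Adj G y x
  Adj-sym {x} {y} = trans (proj₁ simple y x)

  Adj? : B.Decidable (Adj G)
  Adj? x y = G x y Bool.≟ true

  cycle-via-common-neighbour : ∀ {s t w} ms → let π = s ∷ ms ∷ʳ t in
    3 ≤ length π → Unique π → Linked (Adj G) π → w ∉ π → Adj G s w → Adj G t w → IsCycle G (π ∷ʳ w)
  cycle-via-common-neighbour {s} {t} {w} ms 3≤ π! path w∉π s~w t~w =
    subst (3 ≤_) (↭-length (∷↭∷ʳ w π)) (≤-trans 3≤ (n≤1+n _)) ,
    Unique-resp-↭ (∷↭∷ʳ w π) (¬Any⇒All¬ π w∉π AllPairs.∷ π!) ,
    Cyclic-∷ʳ⁺ (subst (Linked (Adj G)) (cong (s ∷_) (sym (++-assoc ms [ t ] [ w ])))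
                  (Linked-join (s ∷ ms) path (t~w ∷ [-])))
               (Adj-sym s~w)
    where π = s ∷ ms ∷ʳ t

  module _ {s t : Fin n} (s≁t : ¬ Adj G s t) (deg-sum : suc n ≤ deg G s + deg G t) where

    open DecMembership (_≟_ {n}) using (_∈?_)

    adjCount : Fin n → ℕ
    adjCount w = b2n (G s w) + b2n (G t w)

    adjCount≤2 : ∀ w → adjCount w ≤ 2
    adjCount≤2 w = +-mono-≤ (b2n≤1 (G s w)) (b2n≤1 (G t w))

    adjCount-exceeds : ∀ {Γ} → Unique Γ → (∀ w → w ∉ Γ → adjCount w ≤ 1) → length Γ < sum (map adjCount Γ)
    adjCount-exceeds {Γ} Γ! outside≤1 = ≰⇒> λ sum≤length →
      1+n≰n (≤-trans deg-sum (subst (_≤ n) deg≡ (total sum≤length)))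
      where
      deg≡ : sum (map adjCount (allFin n)) ≡ deg G s + deg G t
      deg≡ = sum-map-+ (λ w → b2n (G s w)) (λ w → b2n (G t w)) (allFin n)
      total : sum (map adjCount Γ) ≤ length Γ → sum (map adjCount (allFin n)) ≤ n
      total bound = subst (sum (map adjCount (allFin n)) ≤_) (length-tabulate (λ w → w))
        (sum-≤-length _≟_ adjCount (allFin⁺ n) Γ! (λ _ → ∈-allFin _) outside≤1 bound)

    Uncrossed : Fin n → Fin n → Set
    Uncrossed p q = b2n (G t p) + b2n (G s q) ≤ 1

    Uncrossed? : B.Decidable Uncrossed
    Uncrossed? p q = _ ≤? 1

    uncrossed-bound : ∀ ms → Linked Uncrossed ms → sum (map adjCount (s ∷ ms ∷ʳ t)) < length (s ∷ ms ∷ʳ t)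
    uncrossed-bound ms l = s≤s (subst (sum (map adjCount (s ∷ ms ∷ʳ t)) ≤_) ends
      (sum-Linked-≤ (λ w → b2n (G s w)) (λ w → b2n (G t w)) ms (Linked-∷ from-s (Linked-∷ʳ into-t l))))
      where
      from-s : ∀ y → Uncrossed s y
      from-s y = subst (λ β → b2n β + b2n (G s y) ≤ 1) (sym (¬-not (s≁t ∘ Adj-sym))) (b2n≤1 (G s y))
      into-t : ∀ y → Uncrossed y t
      into-t y = subst (λ β → b2n (G t y) + b2n β ≤ 1) (sym (¬-not s≁t))
                   (subst (_≤ 1) (sym (+-identityʳ _)) (b2n≤1 (G t y)))
      ends : b2n (G s s) + suc (length ms) + b2n (G t t) ≡ length (ms ∷ʳ t)
      ends = begin
        b2n (G s s) + suc (length ms) + b2n (G t t) ≡⟨ cong₂ (λ α β → b2n α + suc (length ms) + b2n β)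
                                                              (proj₂ simple s) (proj₂ simple t) ⟩
        suc (length ms) + 0                         ≡⟨ +-identityʳ _ ⟩
        suc (length ms)                             ≡⟨ +-comm 1 (length ms) ⟩
        length ms + 1                               ≡⟨ sym (length-++ ms) ⟩
        length (ms ∷ʳ t)                            ∎
        where open ≡-Reasoning

    path-closes-to-cycle : ∀ ms → let π = s ∷ ms ∷ʳ t in
      3 ≤ length π → Unique π → Linked (Adj G) π →
      ∃ λ Γ → IsCycle G Γ × (∀ {w} → w ∈ π → w ∈ Γ) × (Spanning Γ → Spanning π)
    path-closes-to-cycle ms 3≤ π! path with Linked-break Uncrossed? ms
    ... | inj₂ (as , bs , p , q , refl , crossed) =
      let t~p , s~q = b2n+b2n≰1⇒both (G t p) (G s q) crossed
          Γ , cyc , Γ↭π = Cyclic-crossing Adj-sym as bs path (Adj-sym t~p) (Adj-sym s~q)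
      in Γ , (subst (3 ≤_) (sym (↭-length Γ↭π)) 3≤ , Unique-resp-↭ (↭-sym Γ↭π) π! , cyc)
           , ∈-resp-↭ (↭-sym Γ↭π) , λ spans w → ∈-resp-↭ Γ↭π (spans w)
    ... | inj₁ uncrossed
        with any? (λ w → ¬? (w ∈? (s ∷ ms ∷ʳ t)) ×-dec (Adj? s w ×-dec Adj? t w))
    ...   | no no-common = ⊥-elim (<⇒≱ (adjCount-exceeds π! outside) (<⇒≤ (uncrossed-bound ms uncrossed)))
      where
      outside : ∀ w → w ∉ s ∷ ms ∷ʳ t → adjCount w ≤ 1
      outside w w∉π = ¬both⇒b2n+b2n≤1 (G s w) (G t w) λ both → no-common (w , w∉π , both)
    ...   | yes (w , w∉π , s~w , t~w) =
      π ∷ʳ w , cyc , ∈-++⁺ˡ ,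
      λ spans → ⊥-elim (<⇒≱ (adjCount-exceeds (proj₁ (proj₂ cyc)) (nothing-outside spans)) bound)
      where
      π = s ∷ ms ∷ʳ t
      cyc : IsCycle G (π ∷ʳ w)
      cyc = cycle-via-common-neighbour ms 3≤ π! path w∉π s~w t~w
      nothing-outside : Spanning (π ∷ʳ w) → ∀ x → x ∉ π ∷ʳ w → adjCount x ≤ 1
      nothing-outside spans x x∉ = ⊥-elim (x∉ (spans x))
      bound : sum (map adjCount (π ∷ʳ w)) ≤ length (π ∷ʳ w)
      bound = begin
        sum (map adjCount (π ∷ʳ w))             ≡⟨ cong sum (map-++ adjCount π [ w ]) ⟩
        sum (map adjCount π ∷ʳ adjCount w)      ≡⟨ sum-++ (map adjCount π) [ adjCount w ] ⟩
        sum (map adjCount π) + (adjCount w + 0) ≡⟨ cong (sum (map adjCount π) +_) (+-identityʳ _) ⟩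
        sum (map adjCount π) + adjCount w       ≤⟨ +-monoʳ-≤ (sum (map adjCount π)) (adjCount≤2 w) ⟩
        sum (map adjCount π) + 2                ≡⟨ +-comm _ 2 ⟩
        suc (suc (sum (map adjCount π)))        ≤⟨ s≤s (uncrossed-bound ms uncrossed) ⟩
        suc (length π)                          ≡⟨ ↭-length (∷↭∷ʳ w π) ⟩
        length (π ∷ʳ w)                         ∎
        where open ≤-Reasoning

  module _ {u v : Fin n} where

    addEdge-⊇ : ∀ {x y} → Adj G x y → Adj (addEdge G u v) x y
    addEdge-⊇ x~y rewrite x~y = refl

    addEdge-new : ∀ {x y} → Adj (addEdge G u v) x y → ¬ Adj G x y → Joins u v x y
    addEdge-new {x} {y} x~⁺y x≁y with Equivalence.to (T-∨ {G x y}) (Equivalence.from T-≡ x~⁺y)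
    ... | inj₁ x~y = ⊥-elim (x≁y (Equivalence.to T-≡ x~y))
    ... | inj₂ new with Equivalence.to (T-∨ {⌊ x ≟ u ⌋ ∧ ⌊ y ≟ v ⌋}) new
    ...   | inj₁ uv = inj₁ (T-⌊⌋∧⌊⌋ (x ≟ u) (y ≟ v) uv)
    ...   | inj₂ vu = inj₂ (T-⌊⌋∧⌊⌋ (x ≟ v) (y ≟ u) vu)

    addEdge-edge : ∀ {x y} → Adj (addEdge G u v) x y → Adj G x y ⊎ Joins u v x y
    addEdge-edge {x} {y} x~⁺y with Adj? x y
    ... | yes x~y = inj₁ x~y
    ... | no  x≁y = inj₂ (addEdge-new x~⁺y x≁y)

    cycle⇒cycle-of-addEdge : ∀ {C} → IsCycle G C → IsCycle (addEdge G u v) C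
    cycle⇒cycle-of-addEdge (3≤ , C! , cyc) = 3≤ , C! , Linked.map addEdge-⊇ cyc

    -- A new edge joins p and q, and past its first edge the path no longer meets q.
    addEdge-path : ∀ {p q} ms → Joins u v p q → 3 ≤ length (q ∷ ms ∷ʳ p) → Unique (q ∷ ms ∷ʳ p) →
      Linked (Adj (addEdge G u v)) (q ∷ ms ∷ʳ p) → Linked (Adj G) (q ∷ ms ∷ʳ p)
    addEdge-path []       _     (s≤s (s≤s ())) _ _
    addEdge-path {p} {q} (m ∷ ms) joins _ π! (q~⁺m ∷ tail⁺) =
      first-edge ∷ Linked-avoiding avoids-q (Unique[x∷xs]⇒x∉xs π!) tail⁺
      where
      avoids-q : ∀ {x y} → Adj (addEdge G u v) x y → Adj G x y ⊎ (x ≡ q ⊎ y ≡ q)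
      avoids-q = Data.Sum.map₂ (Joins-touches (Joins-sym joins)) ∘ addEdge-edge
      first-edge : Adj G q m
      first-edge with addEdge-edge q~⁺m
      ... | inj₁ q~m = q~m
      ... | inj₂ qm with Joins-touches joins qm
      ...   | inj₁ refl = ⊥-elim (Unique[x∷xs]⇒x∉xs π! (∈-++⁺ʳ (m ∷ ms) (here refl)))
      ...   | inj₂ refl = ⊥-elim (Unique[x∷xs]⇒x∉xs (AllPairs.tail π!) (∈-++⁺ʳ ms (here refl)))

  module _ {u v : Fin n} (u≁v : ¬ Adj G u v) (deg-sum : suc n ≤ deg G u + deg G v) where

    cycle-of-addEdge⇒cycle : ∀ {C} → IsCycle (addEdge G u v) C →
      ∃ λ Γ → IsCycle G Γ × (∀ {w} → w ∈ C → w ∈ Γ) × (Spanning Γ → Spanning C)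
    cycle-of-addEdge⇒cycle {C} (3≤ , C! , cyc⁺) with Cyclic-open Adj? (≤-trans (n≤1+n 2) 3≤) cyc⁺
    ... | inj₁ cyc = C , (3≤ , C! , cyc) , (λ w∈C → w∈C) , (λ spans → spans)
    ... | inj₂ (p , q , ms , p~⁺q , p≁q , path⁺ , π↭C) =
      let joins = addEdge-new p~⁺q p≁q
          3≤π = subst (3 ≤_) (sym (↭-length π↭C)) 3≤
          π! = Unique-resp-↭ (↭-sym π↭C) C!
          Γ , cyc , π⊆Γ , Γ-spans⇒π-spans =
            closes (Joins-sym joins) ms 3≤π π! (addEdge-path ms joins 3≤π π! path⁺)
      in Γ , cyc , π⊆Γ ∘ ∈-resp-↭ (↭-sym π↭C) , λ spans w → ∈-resp-↭ π↭C (Γ-spans⇒π-spans spans w)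
      where
      closes : ∀ {s t} → Joins u v s t → ∀ ms → let π = s ∷ ms ∷ʳ t in
        3 ≤ length π → Unique π → Linked (Adj G) π →
        ∃ λ Γ → IsCycle G Γ × (∀ {w} → w ∈ π → w ∈ Γ) × (Spanning Γ → Spanning π)
      closes (inj₁ (refl , refl)) = path-closes-to-cycle u≁v deg-sum
      closes (inj₂ (refl , refl)) =
        path-closes-to-cycle (u≁v ∘ Adj-sym) (subst (suc n ≤_) (+-comm (deg G u) _) deg-sum)

    Hamiltonian-addEdge⁻ : Hamiltonian (addEdge G u v) → Hamiltonian G
    Hamiltonian-addEdge⁻ (C , cyc⁺ , C-spans) =
      let Γ , cyc , C⊆Γ , _ = cycle-of-addEdge⇒cycle cyc⁺ in Γ , cyc , λ w → C⊆Γ (C-spans w)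

    IsHForceSet-addEdge⁺ : ∀ {X} → IsHForceSet G X → IsHForceSet (addEdge G u v) X
    IsHForceSet-addEdge⁺ {X} ((C , cyc , C-spans) , X≢∅ , forces) =
      (C , cycle⇒cycle-of-addEdge cyc , C-spans) , X≢∅ , forces⁺
      where
      forces⁺ : ∀ C → IsXCycle (addEdge G u v) X C → IsHamCycle (addEdge G u v) C
      forces⁺ C (cyc⁺ , X⊆C) =
        let Γ , cyc , C⊆Γ , Γ-spans⇒C-spans = cycle-of-addEdge⇒cycle cyc⁺
        in cyc⁺ , Γ-spans⇒C-spans (proj₂ (forces Γ (cyc , λ w w∈X → C⊆Γ (X⊆C w w∈X))))

    IsHForceSet-addEdge⁻ : ∀ {X} → IsHForceSet (addEdge G u v) X → IsHForceSet G X
    IsHForceSet-addEdge⁻ (ham⁺ , X≢∅ , forces⁺) =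
      Hamiltonian-addEdge⁻ ham⁺ , X≢∅ ,
      λ C (cyc , X⊆C) → cyc , proj₂ (forces⁺ C (cycle⇒cycle-of-addEdge cyc , X⊆C))

IsMinHForceSet-transfer : ∀ {n} {G H : Graph n} →
  (∀ {Y} → IsHForceSet G Y → IsHForceSet H Y) → (∀ {Y} → IsHForceSet H Y → IsHForceSet G Y) →
  ∀ {X} → IsMinHForceSet G X → IsMinHForceSet H X
IsMinHForceSet-transfer G⇒H H⇒G (X-forces , X-min) = G⇒H X-forces , λ Y Y-forces → X-min Y (H⇒G Y-forces)

module _ {n} {G H : Graph n} (same : ∀ X → IsHForceSet G X ⇔ IsHForceSet H X) where

  IsMinHForceSet-cong : ∀ X → IsMinHForceSet G X ⇔ IsMinHForceSet H X
  IsMinHForceSet-cong X = mk⇔ (IsMinHForceSet-transfer G⇒H H⇒G) (IsMinHForceSet-transfer H⇒G G⇒H)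
    where
    G⇒H = λ {Y} → Equivalence.to (same Y)
    H⇒G = λ {Y} → Equivalence.from (same Y)

  HForceNumber-cong : ∀ k → HForceNumber G k ⇔ HForceNumber H k
  HForceNumber-cong k = mk⇔ (Prod.map₂ (Prod.map₁ (Equivalence.to (IsMinHForceSet-cong _))))
                             (Prod.map₂ (Prod.map₁ (Equivalence.from (IsMinHForceSet-cong _))))

lemma2p1 : ∀ {n} (G : Graph n) → IsSimple G → IsOTG G →
    (X : Subset n) (u v : Fin n) → u ≢ v → ¬ Adj G u v →
    suc n ≤ deg G u + deg G v →
    (IsHForceSet G X ⇔ IsHForceSet (addEdge G u v) X)
    × (IsMinHForceSet G X ⇔ IsMinHForceSet (addEdge G u v) X)
    × (∀ k → HForceNumber G k ⇔ HForceNumber (addEdge G u v) k)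
lemma2p1 G simple _ X u v _ u≁v deg-sum =
  same-force X , IsMinHForceSet-cong same-force X , HForceNumber-cong same-force
  where
  same-force : ∀ Y → IsHForceSet G Y ⇔ IsHForceSet (addEdge G u v) Y
  same-force Y = mk⇔ (IsHForceSet-addEdge⁺ simple u≁v deg-sum) (IsHForceSet-addEdge⁻ simple u≁v deg-sum)
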